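{- Let $f\in\mathbb{Q}_p[T]$ be a nonzero $p$-adic polynomial and $x\in\mathbb{Z}_p$. For every integer $s\ge 1+\frac{\log\kappa(f,x)}{\log p}$, it holds that $\mathrm{St}(f;x,p^{ -s})\le1$.
   Context: $|\cdot|$ is the $p$-adic absolute value, $\|f\|:=\max_k|f_k|$ for $f=\sum_kf_kT^k$, and $\kappa(f,x):=\|f\|/\max\{|f(x)|,|f'(x)|\}\in(0,\infty]$. For nonzero $f$, $\mathrm{St}(f):=\max\{k\in\mathbb{N}:|f_l|\le|f_k|\text{ for all }l<k\}$ (with $f_k=0$ for $k>\deg f$) and $\mathrm{St}(f;x,p^{ -s}):=\mathrm{St}(f(x+p^sT))$. -}

module Defs where

open import Data.Nat using (ℕ; zero; suc; _+_; _*_; _∸_; _^_; _<_; NonZero)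
open import Data.Nat.Properties using (m^n≢0)
open import Data.Nat.DivMod using (_/_; _%_; m%n<n)
open import Data.Fin using (Fin; toℕ; fromℕ<)
open import Data.Integer as ℤ using (ℤ; +_; -[1+_])
open import Data.List using (List; []; _∷_; map; foldr)
open import Data.Product using (_×_)
open import Relation.Binary.PropositionalEquality using (_≡_)

-- p-adic numbers for a fixed base p.
-- An element of ℤ_p is a stream of base-p digits u 0, u 1, … ,
-- representing Σ_i u i · p^i.  An element of ℚ_p is p^(-den) · num.
module _ (p : ℕ) .{{nz : NonZero p}} where

  divPow : ℕ → ℕ → ℕ
  divPow m i = _/_ m (p ^ i) {{m^n≢0 p i}}

  digit : ℕ → Fin p
  digit m = fromℕ< (m%n<n m p)

  Zp : Set
  Zp = ℕ → Fin p

  res : Zp → ℕ → ℕ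
  res u zero    = 0
  res u (suc n) = res u n + toℕ (u n) * p ^ n

  natZ : ℕ → Zp
  natZ m i = digit (divPow m i)

  addZ : Zp → Zp → Zp
  addZ a b i = digit (divPow (res a (suc i) + res b (suc i)) i)

  mulZ : Zp → Zp → Zp
  mulZ a b i = digit (divPow (res a (suc i) * res b (suc i)) i)

  negZ : Zp → Zp
  negZ a i = digit (divPow (p ^ suc i ∸ res a (suc i)) i)

  shiftZ : ℕ → Zp → Zp
  shiftZ zero    u i       = u i
  shiftZ (suc k) u zero    = digit 0
  shiftZ (suc k) u (suc i) = shiftZ k u i

  record Qp : Set where
    constructor _/p^_
    field
      num : Zp
      den : ℕ
  open Qp public

  fromZp : Zp → Qp
  fromZp x = x /p^ 0

  zeroQ oneQ : Qp
  zeroQ = natZ 0 /p^ 0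
  oneQ  = natZ 1 /p^ 0

  addQ : Qp → Qp → Qp
  addQ a b = addZ (shiftZ (den b) (num a)) (shiftZ (den a) (num b)) /p^ (den a + den b)

  mulQ : Qp → Qp → Qp
  mulQ a b = mulZ (num a) (num b) /p^ (den a + den b)

  negQ : Qp → Qp
  negQ a = negZ (num a) /p^ den a

  natQ : ℕ → Qp
  natQ m = natZ m /p^ 0

  powQ : ℤ → Qp
  powQ (+ n)     = shiftZ n (natZ 1) /p^ 0
  powQ -[1+ n ]  = natZ 1 /p^ suc n

  -- v_p(a) ≥ n   (n ∈ ℤ), i.e. |a| ≤ p^(-n)
  VGe : Qp → ℤ → Set
  VGe a n = ∀ (m : ℕ) → (+ m) ℤ.≤ n ℤ.+ (+ den a) → res (num a) m ≡ 0

  IsZeroQ : Qp → Set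
  IsZeroQ a = ∀ n → VGe a n

  AbsLe : Qp → Qp → Set
  AbsLe a b = ∀ n → VGe b n → VGe a n

  AbsLeMax : Qp → Qp → Qp → Set
  AbsLeMax a b c = ∀ n → VGe b n → VGe c n → VGe a n

  -- polynomials in ℚ_p[T] as coefficient lists f_0, f_1, …
  Poly : Set
  Poly = List Qp

  coeff : Poly → ℕ → Qp
  coeff []      k       = zeroQ
  coeff (a ∷ f) zero    = a
  coeff (a ∷ f) (suc k) = coeff f k

  addP : Poly → Poly → Poly
  addP []      g       = g
  addP (a ∷ f) []      = a ∷ f
  addP (a ∷ f) (b ∷ g) = addQ a b ∷ addP f g

  mulP : Poly → Poly → Poly
  mulP []      g = []
  mulP (a ∷ f) g = addP (map (mulQ a) g) (zeroQ ∷ mulP f g)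

  compP : Poly → Poly → Poly
  compP []      g = []
  compP (a ∷ f) g = addP (a ∷ []) (mulP g (compP f g))

  eval : Poly → Qp → Qp
  eval f x = foldr (λ a acc → addQ a (mulQ x acc)) zeroQ f

  derivFrom : ℕ → Poly → Poly
  derivFrom k []      = []
  derivFrom k (a ∷ f) = mulQ (natQ k) a ∷ derivFrom (suc k) f

  deriv : Poly → Poly
  deriv []      = []
  deriv (a ∷ f) = derivFrom 1 f

  shiftPoly : Poly → Qp → ℤ → Poly
  shiftPoly f x s = compP f (x ∷ powQ s ∷ [])

  -- k is in the set whose maximum is St(g):  |g_l| ≤ |g_k| for all l < k
  StCand : Poly → ℕ → Set
  StCand g k = ∀ l → l < k → AbsLe (coeff g l) (coeff g k)

  -- s ≥ 1 + log κ(f,x) / log p, i.e. p^(s-1) ≥ κ(f,x) = ‖f‖ / max{|f(x)|,|f'(x)|},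
  -- i.e. |f_k| ≤ max{|p^(1-s) f(x)|, |p^(1-s) f'(x)|} for all k
  -- (false when f(x) = f'(x) = 0, where κ = ∞, since f ≠ 0)
  KappaBound : Poly → Zp → ℤ → Set
  KappaBound f x s = ∀ k → AbsLeMax (coeff f k)
                                    (mulQ (powQ (ℤ.1ℤ ℤ.- s)) (eval f (fromZp x)))
                                    (mulQ (powQ (ℤ.1ℤ ℤ.- s)) (eval (deriv f) (fromZp x)))

{-# OPTIONS --safe #-}
module Submission where

-- Put P = p^(1-s) f(x) and Q = p^(1-s) f'(x); the hypothesis on s says |f_j| ≤ max(|P|, |Q|) for all j.
-- Suppose some k ≥ 2 satisfies |g_l| ≤ |g_k| for all l < k, where g = f(x + p^s T).  If every |f_j| is at
-- most p^(-n), then |g_k| ≤ p^(-n-2s), so |g₀| = |f(x)| and |g₁| = |p^s f'(x)| obey the same bound and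
-- therefore |P|, |Q| ≤ p^(-n-1) (for s < 0 this already follows from x ∈ ℤ_p, without g).  Starting from a
-- trivial bound and iterating, every coefficient of f has arbitrarily large valuation, so f = 0.

open import Data.Empty using (⊥-elim)
open import Data.Fin using (toℕ)
open import Data.Fin.Properties using (toℕ<n; toℕ-fromℕ<)
open import Data.Integer as ℤ using (ℤ; +_; -[1+_]; 1ℤ)
import Data.Integer.Properties as ℤP
import Data.Integer.Tactic.RingSolver as ℤSolver
open import Data.List using ([]; _∷_; map)
open import Data.Nat
open import Data.Nat.DivMod
open import Data.Nat.Divisibility using (divides)
open import Data.Nat.Primality using (Prime)
open import Data.Nat.Properties
open import Data.Nat.Tactic.RingSolver using (solve-∀)
open import Data.Product using (Σ; _,_; _×_; proj₁; proj₂)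
open import Data.Sum using (inj₁; inj₂)
open import Relation.Binary.Bundles using (Setoid)
open import Relation.Binary.PropositionalEquality
import Relation.Binary.Reasoning.Setoid as SetoidReasoning
open import Relation.Nullary using (¬_)

open import Defs

max0 : ℤ → ℕ
max0 (+ n)    = n
max0 -[1+ n ] = 0

≤max0 : ∀ z → z ℤ.≤ + max0 z
≤max0 (+ n)    = ℤP.≤-refl
≤max0 -[1+ n ] = ℤ.-≤+

max0-≤ : ∀ z k → z ℤ.≤ + k → max0 z ≤ k
max0-≤ (+ n)    k (ℤ.+≤+ n≤k) = n≤k
max0-≤ -[1+ n ] k _           = z≤n

≤-max0 : ∀ m z → + m ℤ.≤ z → m ≤ max0 z
≤-max0 m (+ n) (ℤ.+≤+ m≤n) = m≤n

max0-+ : ∀ x y → max0 (x ℤ.+ y) ≤ max0 x + max0 y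
max0-+ x y = max0-≤ (x ℤ.+ y) _
  (subst (x ℤ.+ y ℤ.≤_) (sym (ℤP.pos-+ (max0 x) (max0 y))) (ℤP.+-mono-≤ (≤max0 x) (≤max0 y)))

ℤ-upward-induction : ∀ {ℓ} (A : ℤ → Set ℓ) → (∀ {m n} → m ℤ.≤ n → A n → A m) →
                     ∀ n₀ → A n₀ → (∀ n → A n → A (n ℤ.+ 1ℤ)) → ∀ n → A n
ℤ-upward-induction A antitone n₀ base step n =
  antitone (ℤP.≤-trans (ℤP.≤-reflexive n≡) (ℤP.+-monoʳ-≤ n₀ (≤max0 (n ℤ.- n₀)))) (iterate (max0 (n ℤ.- n₀)))
  where
  n≡ : n ≡ n₀ ℤ.+ (n ℤ.- n₀)
  n≡ = add-sub n₀ n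
    where
    add-sub : ∀ a b → b ≡ a ℤ.+ (b ℤ.- a)
    add-sub = ℤSolver.solve-∀
  iterate : ∀ j → A (n₀ ℤ.+ + j)
  iterate zero    = subst A (sym (ℤP.+-identityʳ n₀)) base
  iterate (suc j) = subst A n₀+j+1≡ (step _ (iterate j))
    where
    n₀+j+1≡ : n₀ ℤ.+ + j ℤ.+ 1ℤ ≡ n₀ ℤ.+ + suc j
    n₀+j+1≡ = begin
        n₀ ℤ.+ + j ℤ.+ 1ℤ   ≡⟨ ℤP.+-assoc n₀ (+ j) 1ℤ ⟩
        n₀ ℤ.+ (+ j ℤ.+ 1ℤ) ≡⟨ cong (λ z → n₀ ℤ.+ z) (ℤP.+-comm (+ j) 1ℤ) ⟩
        n₀ ℤ.+ (1ℤ ℤ.+ + j) ≡⟨ cong (λ z → n₀ ℤ.+ z) (sym (ℤP.pos-+ 1 j)) ⟩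
        n₀ ℤ.+ + suc j      ∎
      where open ≡-Reasoning

module _ (p : ℕ) .{{_ : NonZero p}} where

  -- Residues of p-adic digit streams

  p^≢0 : ∀ K → NonZero (p ^ K)
  p^≢0 K = m^n≢0 p K

  infixl 7 _%p^_
  _%p^_ : ℕ → ℕ → ℕ
  x %p^ K = _%_ x (p ^ K) {{p^≢0 K}}

  infix 4 _≡_[p^_]
  _≡_[p^_] : ℕ → ℕ → ℕ → Set
  x ≡ y [p^ K ] = x %p^ K ≡ y %p^ K

  ≡[p^]-+ : ∀ K {x x' y y'} → x ≡ x' [p^ K ] → y ≡ y' [p^ K ] → x + y ≡ x' + y' [p^ K ]
  ≡[p^]-+ K {x} {x'} {y} {y'} x≡x' y≡y' =
    trans (%-distribˡ-+ x y (p ^ K) {{p^≢0 K}})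
      (trans (cong₂ (λ a b → (a + b) %p^ K) x≡x' y≡y') (sym (%-distribˡ-+ x' y' (p ^ K) {{p^≢0 K}})))

  ≡[p^]-* : ∀ K {x x' y y'} → x ≡ x' [p^ K ] → y ≡ y' [p^ K ] → x * y ≡ x' * y' [p^ K ]
  ≡[p^]-* K {x} {x'} {y} {y'} x≡x' y≡y' =
    trans (%-distribˡ-* x y (p ^ K) {{p^≢0 K}})
      (trans (cong₂ (λ a b → (a * b) %p^ K) x≡x' y≡y') (sym (%-distribˡ-* x' y' (p ^ K) {{p^≢0 K}})))

  ≡[p^]-*ˡ : ∀ K c {y y'} → y ≡ y' [p^ K ] → c * y ≡ c * y' [p^ K ]
  ≡[p^]-*ˡ K c = ≡[p^]-* K {c} {c} refl

  %p^⇒≡[p^] : ∀ K {x} y → x ≡ y %p^ K → x ≡ y [p^ K ]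
  %p^⇒≡[p^] K y x≡ = trans (cong (_%p^ K) x≡) (m%n%n≡m%n y (p ^ K) {{p^≢0 K}})

  ≡[p^]-cancel : ∀ e K x y → p ^ e * x ≡ p ^ e * y [p^ e + K ] → x ≡ y [p^ K ]
  ≡[p^]-cancel e K x y eq = *-cancelʳ-≡ (x %p^ K) (y %p^ K) (p ^ e) {{p^≢0 e}} (trans (shift x) (trans eq (sym (shift y))))
    where
    instance
      p^K*p^e≢0 : NonZero (p ^ K * p ^ e)
      p^K*p^e≢0 = m*n≢0 (p ^ K) (p ^ e) {{p^≢0 K}} {{p^≢0 e}}
    shift : ∀ z → z %p^ K * p ^ e ≡ (p ^ e * z) %p^ (e + K)
    shift z = begin
        z %p^ K * p ^ e             ≡⟨ m%n*o≡m*o%[n*o] z (p ^ K) (p ^ e) {{p^≢0 K}} ⟩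
        (z * p ^ e) % (p ^ K * p ^ e) ≡⟨ %-congʳ {{_}} {{p^≢0 (e + K)}} (trans (*-comm (p ^ K) (p ^ e)) (sym (^-distribˡ-+-* p e K))) ⟩
        (z * p ^ e) %p^ (e + K)     ≡⟨ cong (_%p^ (e + K)) (*-comm z (p ^ e)) ⟩
        (p ^ e * z) %p^ (e + K)     ∎
      where open ≡-Reasoning

  p^*-%p^≡0 : ∀ K M X → K ≤ M → (p ^ M * X) %p^ K ≡ 0
  p^*-%p^≡0 K M X K≤M = trans (cong (_%p^ K) p^M*X≡) (m*n%n≡0 (p ^ (M ∸ K) * X) (p ^ K) {{p^≢0 K}})
    where
    p^M*X≡ : p ^ M * X ≡ p ^ (M ∸ K) * X * p ^ K
    p^M*X≡ = begin
        p ^ M * X                   ≡⟨ cong (λ z → p ^ z * X) (sym (m∸n+n≡m K≤M)) ⟩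
        p ^ (M ∸ K + K) * X         ≡⟨ cong (_* X) (^-distribˡ-+-* p (M ∸ K) K) ⟩
        p ^ (M ∸ K) * p ^ K * X     ≡⟨ swap (p ^ (M ∸ K)) (p ^ K) X ⟩
        p ^ (M ∸ K) * X * p ^ K     ∎
      where
      open ≡-Reasoning
      swap : ∀ a b c → a * b * c ≡ a * c * b
      swap = solve-∀

  toℕ-digit : ∀ m → toℕ (digit p m) ≡ m % p
  toℕ-digit m = toℕ-fromℕ< (m%n<n m p)

  %p^-suc : ∀ G K → G %p^ suc K ≡ G %p^ K + (divPow p G K % p) * p ^ K
  %p^-suc G K = begin
      G %p^ suc K
    ≡⟨ m≡m%n+[m/n]*n (G %p^ suc K) (p ^ K) {{p^≢0 K}} ⟩
      G %p^ suc K %p^ K + divPow p (G %p^ suc K) K * p ^ K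
    ≡⟨ cong₂ (λ a b → a + b * p ^ K) (m∣n⇒o%n%m≡o%m (p ^ K) (p ^ suc K) G {{p^≢0 K}} {{p^≢0 (suc K)}} (divides p refl))
                                     (m%[n*o]/o≡m/o%n G p (p ^ K) {{_}} {{p^≢0 K}} {{p^≢0 (suc K)}}) ⟩
      G %p^ K + (divPow p G K % p) * p ^ K ∎
    where open ≡-Reasoning

  res<p^ : ∀ u K → res p u K < p ^ K
  res<p^ u zero    = s≤s z≤n
  res<p^ u (suc K) = begin-strict
      res p u K + toℕ (u K) * p ^ K  <⟨ +-monoˡ-< (toℕ (u K) * p ^ K) (res<p^ u K) ⟩
      suc (toℕ (u K)) * p ^ K        ≤⟨ *-monoˡ-≤ (p ^ K) (toℕ<n (u K)) ⟩
      p * p ^ K                      ∎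
    where open ≤-Reasoning

  res-+ : ∀ u L j → res p u (L + j) ≡ res p u L + p ^ L * res p (λ i → u (L + i)) j
  res-+ u L zero    rewrite +-identityʳ L | *-zeroʳ (p ^ L) | +-identityʳ (res p u L) = refl
  res-+ u L (suc j) rewrite +-suc L j | res-+ u L j | ^-distribˡ-+-* p L j =
    regroup (res p u L) (p ^ L) (res p (λ i → u (L + i)) j) (toℕ (u (L + j))) (p ^ j)
    where
    regroup : ∀ a b c d e → a + b * c + d * (b * e) ≡ a + b * (c + d * e)
    regroup = solve-∀

  res-%p^ : ∀ u {L K} → L ≤ K → res p u K %p^ L ≡ res p u L
  res-%p^ u {L} {K} L≤K = begin
      res p u K %p^ L                    ≡⟨ cong (λ K → res p u K %p^ L) (sym (m+[n∸m]≡n L≤K)) ⟩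
      res p u (L + j) %p^ L              ≡⟨ cong (_%p^ L) (res-+ u L j) ⟩
      (res p u L + p ^ L * high) %p^ L   ≡⟨ cong (λ z → (res p u L + z) %p^ L) (*-comm (p ^ L) high) ⟩
      (res p u L + high * p ^ L) %p^ L   ≡⟨ [m+kn]%n≡m%n (res p u L) high (p ^ L) {{p^≢0 L}} ⟩
      res p u L %p^ L                    ≡⟨ m<n⇒m%n≡m {{p^≢0 L}} (res<p^ u L) ⟩
      res p u L                          ∎
    where
    open ≡-Reasoning
    j = K ∸ L
    high = res p (λ i → u (L + i)) j

  res-≡[p^] : ∀ u {L K} → L ≤ K → res p u K ≡ res p u L [p^ L ]
  res-≡[p^] u {L} L≤K = trans (res-%p^ u L≤K) (sym (m<n⇒m%n≡m {{p^≢0 L}} (res<p^ u L)))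

  res-digitwise : (F : ℕ → ℕ) (G K : ℕ) → (∀ i → i < K → F i ≡ G [p^ suc i ]) →
                  res p (λ i → digit p (divPow p (F i) i)) K ≡ G %p^ K
  res-digitwise F G zero    _     = sym (n%1≡0 G)
  res-digitwise F G (suc K) F≡G = begin
      res p u K + toℕ (u K) * p ^ K
    ≡⟨ cong₂ (λ a b → a + b * p ^ K) (res-digitwise F G K (λ i i<K → F≡G i (m<n⇒m<1+n i<K))) (toℕ-digit _) ⟩
      G %p^ K + (divPow p (F K) K % p) * p ^ K
    ≡⟨ cong (λ a → G %p^ K + a * p ^ K) digitK ⟩
      G %p^ K + (divPow p G K % p) * p ^ K
    ≡⟨ sym (%p^-suc G K) ⟩
      G %p^ suc K ∎
    where
    open ≡-Reasoning
    u = λ i → digit p (divPow p (F i) i)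
    digitK : divPow p (F K) K % p ≡ divPow p G K % p
    digitK = begin
        divPow p (F K) K % p         ≡⟨ sym (m%[n*o]/o≡m/o%n (F K) p (p ^ K) {{_}} {{p^≢0 K}} {{p^≢0 (suc K)}}) ⟩
        divPow p (F K %p^ suc K) K   ≡⟨ cong (λ z → divPow p z K) (F≡G K ≤-refl) ⟩
        divPow p (G %p^ suc K) K     ≡⟨ m%[n*o]/o≡m/o%n G p (p ^ K) {{_}} {{p^≢0 K}} {{p^≢0 (suc K)}} ⟩
        divPow p G K % p             ∎

  res-natZ : ∀ m K → res p (natZ p m) K ≡ m %p^ K
  res-natZ m K = res-digitwise (λ _ → m) m K (λ _ _ → refl)

  res-addZ : ∀ a b K → res p (addZ p a b) K ≡ (res p a K + res p b K) %p^ K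
  res-addZ a b K = res-digitwise (λ i → res p a (suc i) + res p b (suc i)) (res p a K + res p b K) K
    (λ i i<K → ≡[p^]-+ (suc i) (sym (res-≡[p^] a i<K)) (sym (res-≡[p^] b i<K)))

  res-mulZ : ∀ a b K → res p (mulZ p a b) K ≡ (res p a K * res p b K) %p^ K
  res-mulZ a b K = res-digitwise (λ i → res p a (suc i) * res p b (suc i)) (res p a K * res p b K) K
    (λ i i<K → ≡[p^]-* (suc i) (sym (res-≡[p^] a i<K)) (sym (res-≡[p^] b i<K)))

  p*-%p^ : ∀ x K → p * (x %p^ K) ≡ (p * x) %p^ suc K
  p*-%p^ x K = begin
      p * (x %p^ K)                 ≡⟨ *-comm p _ ⟩
      x %p^ K * p                   ≡⟨ m%n*o≡m*o%[n*o] x (p ^ K) p {{p^≢0 K}} ⟩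
      (x * p) % (p ^ K * p)         ≡⟨ %-congʳ {{_}} {{p^≢0 (suc K)}} (*-comm (p ^ K) p) ⟩
      (x * p) %p^ suc K             ≡⟨ cong (_%p^ suc K) (*-comm x p) ⟩
      (p * x) %p^ suc K             ∎
    where
    open ≡-Reasoning
    instance
      p^K*p≢0 : NonZero (p ^ K * p)
      p^K*p≢0 = m*n≢0 (p ^ K) p {{p^≢0 K}}

  res-shiftZ : ∀ k u K → res p (shiftZ p k u) K ≡ (p ^ k * res p u K) %p^ K
  res-shiftZ zero    u K       = sym (trans (cong (_%p^ K) (+-identityʳ (res p u K))) (m<n⇒m%n≡m {{p^≢0 K}} (res<p^ u K)))
  res-shiftZ (suc k) u zero    = sym (n%1≡0 (p ^ suc k * res p u 0))
  res-shiftZ (suc k) u (suc K) = begin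
      res p (shiftZ p (suc k) u) (suc K)
    ≡⟨ res-+ (shiftZ p (suc k) u) 1 K ⟩
      toℕ (digit p 0) * 1 + p * 1 * res p (shiftZ p k u) K
    ≡⟨ cong₂ (λ a b → a + p * 1 * b) (cong (_* 1) (toℕ-digit 0)) (res-shiftZ k u K) ⟩
      0 % p * 1 + p * 1 * ((p ^ k * res p u K) %p^ K)
    ≡⟨ cong₂ (λ a b → a * 1 + b * ((p ^ k * res p u K) %p^ K)) (m*n%n≡0 0 p) (*-identityʳ p) ⟩
      p * ((p ^ k * res p u K) %p^ K)
    ≡⟨ cong (p *_) (≡[p^]-*ˡ K (p ^ k) (sym (res-≡[p^] u (n≤1+n K)))) ⟩
      p * ((p ^ k * res p u (suc K)) %p^ K)
    ≡⟨ p*-%p^ _ K ⟩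
      (p * (p ^ k * res p u (suc K))) %p^ suc K
    ≡⟨ cong (_%p^ suc K) (sym (*-assoc p (p ^ k) _)) ⟩
      (p ^ suc k * res p u (suc K)) %p^ suc K ∎
    where open ≡-Reasoning

  -- Equality of p-adic fractions

  numRes : Qp p → ℕ → ℕ
  numRes a = res p (num a)

  -- num a · p^(-den a) = num b · p^(-den b), cross-multiplied and compared modulo every p^K.
  infix 4 _≈_
  record _≈_ (a b : Qp p) : Set where
    constructor mk≈
    field cross : ∀ K → p ^ den b * numRes a K ≡ p ^ den a * numRes b K [p^ K ]
  open _≈_

  ≈-refl : ∀ {a} → a ≈ a
  ≈-refl = mk≈ λ K → refl

  ≈-sym : ∀ {a b} → a ≈ b → b ≈ a
  ≈-sym a≈b = mk≈ λ K → sym (cross a≈b K)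

  -- Multiply the goal by p^(den b) and compare at the finer modulus p^(den b + K).
  ≈-trans : ∀ {a b c} → a ≈ b → b ≈ c → a ≈ c
  ≈-trans {a} {b} {c} a≈b b≈c = mk≈ λ K → let K' = den b + K in begin
      (p ^ den c * numRes a K) %p^ K   ≡⟨ ≡[p^]-*ˡ K (p ^ den c) (sym (res-≡[p^] (num a) (m≤n+m K (den b)))) ⟩
      (p ^ den c * numRes a K') %p^ K  ≡⟨ ≡[p^]-cancel (den b) K _ _ (scaled K') ⟩
      (p ^ den a * numRes c K') %p^ K  ≡⟨ ≡[p^]-*ˡ K (p ^ den a) (res-≡[p^] (num c) (m≤n+m K (den b))) ⟩
      (p ^ den a * numRes c K) %p^ K   ∎
    where
    open ≡-Reasoning
    exchange : ∀ x y z → x * (y * z) ≡ y * (x * z)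
    exchange = solve-∀
    scaled : ∀ K' → p ^ den b * (p ^ den c * numRes a K') ≡ p ^ den b * (p ^ den a * numRes c K') [p^ K' ]
    scaled K' = begin
        (p ^ den b * (p ^ den c * numRes a K')) %p^ K' ≡⟨ cong (_%p^ K') (exchange (p ^ den b) (p ^ den c) _) ⟩
        (p ^ den c * (p ^ den b * numRes a K')) %p^ K' ≡⟨ ≡[p^]-*ˡ K' (p ^ den c) (cross a≈b K') ⟩
        (p ^ den c * (p ^ den a * numRes b K')) %p^ K' ≡⟨ cong (_%p^ K') (exchange (p ^ den c) (p ^ den a) _) ⟩
        (p ^ den a * (p ^ den c * numRes b K')) %p^ K' ≡⟨ ≡[p^]-*ˡ K' (p ^ den a) (cross b≈c K') ⟩
        (p ^ den a * (p ^ den b * numRes c K')) %p^ K' ≡⟨ cong (_%p^ K') (exchange (p ^ den a) (p ^ den b) _) ⟩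
        (p ^ den b * (p ^ den a * numRes c K')) %p^ K' ∎

  Qp-setoid : Setoid _ _
  Qp-setoid = record
    { Carrier       = Qp p
    ; _≈_           = _≈_
    ; isEquivalence = record { refl = ≈-refl ; sym = ≈-sym ; trans = ≈-trans }
    }

  numRes-addQ : ∀ a b K → numRes (addQ p a b) K ≡ p ^ den b * numRes a K + p ^ den a * numRes b K [p^ K ]
  numRes-addQ a b K = trans (%p^⇒≡[p^] K _ (res-addZ _ _ K))
    (≡[p^]-+ K (%p^⇒≡[p^] K _ (res-shiftZ (den b) (num a) K)) (%p^⇒≡[p^] K _ (res-shiftZ (den a) (num b) K)))

  numRes-mulQ : ∀ a b K → numRes (mulQ p a b) K ≡ numRes a K * numRes b K [p^ K ]
  numRes-mulQ a b K = %p^⇒≡[p^] K _ (res-mulZ _ _ K)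

  numRes-natQ : ∀ m n K → numRes (natZ p m /p^ n) K ≡ m [p^ K ]
  numRes-natQ m n K = %p^⇒≡[p^] K m (res-natZ m K)

  numRes-zeroQ : ∀ K → numRes (zeroQ p) K ≡ 0
  numRes-zeroQ K = trans (res-natZ 0 K) (m*n%n≡0 0 (p ^ K) {{p^≢0 K}})

  numRes-powQ-+ : ∀ m K → numRes (powQ p (+ m)) K ≡ p ^ m * 1 [p^ K ]
  numRes-powQ-+ m K = trans (%p^⇒≡[p^] K _ (res-shiftZ m (natZ p 1) K)) (≡[p^]-*ˡ K (p ^ m) (numRes-natQ 1 0 K))

  ≈-by-numRes : ∀ a b (A B : ℕ → ℕ) → (∀ K → numRes a K ≡ A K [p^ K ]) → (∀ K → numRes b K ≡ B K [p^ K ]) →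
                (∀ K → p ^ den b * A K ≡ p ^ den a * B K) → a ≈ b
  ≈-by-numRes a b A B a≡A b≡B cross-eq = mk≈ λ K →
    trans (≡[p^]-*ˡ K (p ^ den b) (a≡A K)) (trans (cong (_%p^ K) (cross-eq K)) (sym (≡[p^]-*ˡ K (p ^ den a) (b≡B K))))

  p^-+ : ∀ m n → p ^ (m + n) ≡ p ^ m * p ^ n
  p^-+ = ^-distribˡ-+-* p

  addQ-comm : ∀ a b → addQ p a b ≈ addQ p b a
  addQ-comm a b = ≈-by-numRes (addQ p a b) (addQ p b a) _ _ (numRes-addQ a b) (numRes-addQ b a)
    λ K → identity (den a) (den b) (numRes a K) (numRes b K)
    where
    identity : ∀ d e u v → p ^ (e + d) * (p ^ e * u + p ^ d * v) ≡ p ^ (d + e) * (p ^ d * v + p ^ e * u)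
    identity d e u v rewrite p^-+ e d | p^-+ d e = ring (p ^ d) (p ^ e) u v
      where
      ring : ∀ x y u v → y * x * (y * u + x * v) ≡ x * y * (x * v + y * u)
      ring = solve-∀

  mulQ-comm : ∀ a b → mulQ p a b ≈ mulQ p b a
  mulQ-comm a b = ≈-by-numRes (mulQ p a b) (mulQ p b a) _ _ (numRes-mulQ a b) (numRes-mulQ b a)
    λ K → identity (den a) (den b) (numRes a K) (numRes b K)
    where
    identity : ∀ d e u v → p ^ (e + d) * (u * v) ≡ p ^ (d + e) * (v * u)
    identity d e u v rewrite p^-+ e d | p^-+ d e = ring (p ^ d) (p ^ e) u v
      where
      ring : ∀ x y u v → y * x * (u * v) ≡ x * y * (v * u)
      ring = solve-∀

  addQ-assoc : ∀ a b c → addQ p (addQ p a b) c ≈ addQ p a (addQ p b c)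
  addQ-assoc a b c = ≈-by-numRes (addQ p (addQ p a b) c) (addQ p a (addQ p b c))
    (λ K → p ^ den c * (p ^ den b * numRes a K + p ^ den a * numRes b K) + p ^ (den a + den b) * numRes c K)
    (λ K → p ^ (den b + den c) * numRes a K + p ^ den a * (p ^ den c * numRes b K + p ^ den b * numRes c K))
    (λ K → trans (numRes-addQ (addQ p a b) c K)
                 (≡[p^]-+ K {y = p ^ (den a + den b) * numRes c K} (≡[p^]-*ˡ K (p ^ den c) (numRes-addQ a b K)) refl))
    (λ K → trans (numRes-addQ a (addQ p b c) K)
                 (≡[p^]-+ K {p ^ (den b + den c) * numRes a K} refl (≡[p^]-*ˡ K (p ^ den a) (numRes-addQ b c K))))
    (λ K → identity (den a) (den b) (den c) (numRes a K) (numRes b K) (numRes c K))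
    where
    identity : ∀ d e f u v w → p ^ (d + (e + f)) * (p ^ f * (p ^ e * u + p ^ d * v) + p ^ (d + e) * w)
                             ≡ p ^ (d + e + f) * (p ^ (e + f) * u + p ^ d * (p ^ f * v + p ^ e * w))
    identity d e f u v w rewrite p^-+ d (e + f) | p^-+ (d + e) f | p^-+ d e | p^-+ e f = ring (p ^ d) (p ^ e) (p ^ f) u v w
      where
      ring : ∀ x y z u v w → x * (y * z) * (z * (y * u + x * v) + x * y * w) ≡ x * y * z * (y * z * u + x * (z * v + y * w))
      ring = solve-∀

  mulQ-assoc : ∀ a b c → mulQ p (mulQ p a b) c ≈ mulQ p a (mulQ p b c)
  mulQ-assoc a b c = ≈-by-numRes (mulQ p (mulQ p a b) c) (mulQ p a (mulQ p b c))
    (λ K → (numRes a K * numRes b K) * numRes c K) (λ K → numRes a K * (numRes b K * numRes c K))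
    (λ K → trans (numRes-mulQ (mulQ p a b) c K) (≡[p^]-* K {y = numRes c K} (numRes-mulQ a b K) refl))
    (λ K → trans (numRes-mulQ a (mulQ p b c) K) (≡[p^]-* K {numRes a K} refl (numRes-mulQ b c K)))
    (λ K → cong₂ (λ d r → p ^ d * r) (sym (+-assoc (den a) (den b) (den c))) (*-assoc (numRes a K) (numRes b K) (numRes c K)))

  mulQ-distribˡ-addQ : ∀ a b c → mulQ p a (addQ p b c) ≈ addQ p (mulQ p a b) (mulQ p a c)
  mulQ-distribˡ-addQ a b c = ≈-by-numRes (mulQ p a (addQ p b c)) (addQ p (mulQ p a b) (mulQ p a c))
    (λ K → numRes a K * (p ^ den c * numRes b K + p ^ den b * numRes c K))
    (λ K → p ^ (den a + den c) * (numRes a K * numRes b K) + p ^ (den a + den b) * (numRes a K * numRes c K))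
    (λ K → trans (numRes-mulQ a (addQ p b c) K) (≡[p^]-* K {numRes a K} refl (numRes-addQ b c K)))
    (λ K → trans (numRes-addQ (mulQ p a b) (mulQ p a c) K)
                 (≡[p^]-+ K (≡[p^]-*ˡ K (p ^ (den a + den c)) (numRes-mulQ a b K))
                            (≡[p^]-*ˡ K (p ^ (den a + den b)) (numRes-mulQ a c K))))
    (λ K → identity (den a) (den b) (den c) (numRes a K) (numRes b K) (numRes c K))
    where
    identity : ∀ d e f u v w → p ^ (d + e + (d + f)) * (u * (p ^ f * v + p ^ e * w))
                             ≡ p ^ (d + (e + f)) * (p ^ (d + f) * (u * v) + p ^ (d + e) * (u * w))
    identity d e f u v w rewrite p^-+ (d + e) (d + f) | p^-+ d (e + f) | p^-+ d e | p^-+ d f | p^-+ e f =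
      ring (p ^ d) (p ^ e) (p ^ f) u v w
      where
      ring : ∀ x y z u v w → x * y * (x * z) * (u * (z * v + y * w)) ≡ x * (y * z) * (x * z * (u * v) + x * y * (u * w))
      ring = solve-∀

  addQ-identityˡ : ∀ a → addQ p (zeroQ p) a ≈ a
  addQ-identityˡ a = ≈-by-numRes (addQ p (zeroQ p) a) a (λ K → p ^ den a * 0 + 1 * numRes a K) (numRes a)
    (λ K → trans (numRes-addQ (zeroQ p) a K) (≡[p^]-+ K (≡[p^]-*ˡ K (p ^ den a) (cong (_%p^ K) (numRes-zeroQ K))) refl))
    (λ K → refl)
    (λ K → ring (p ^ den a) (numRes a K))
    where
    ring : ∀ x u → x * (x * 0 + 1 * u) ≡ x * u
    ring = solve-∀

  mulQ-zeroʳ : ∀ a → mulQ p a (zeroQ p) ≈ zeroQ p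
  mulQ-zeroʳ a = ≈-by-numRes (mulQ p a (zeroQ p)) (zeroQ p) (λ K → numRes a K * 0) (λ K → 0)
    (λ K → trans (numRes-mulQ a (zeroQ p) K) (≡[p^]-* K {numRes a K} refl (cong (_%p^ K) (numRes-zeroQ K))))
    (λ K → cong (_%p^ K) (numRes-zeroQ K))
    (λ K → ring (p ^ (den a + 0)) (numRes a K))
    where
    ring : ∀ x u → 1 * (u * 0) ≡ x * 0
    ring = solve-∀

  mulQ-identityˡ : ∀ a → mulQ p (oneQ p) a ≈ a
  mulQ-identityˡ a = ≈-by-numRes (mulQ p (oneQ p) a) a (λ K → 1 * numRes a K) (numRes a)
    (λ K → trans (numRes-mulQ (oneQ p) a K) (≡[p^]-* K {y = numRes a K} (numRes-natQ 1 0 K) refl))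
    (λ K → refl)
    (λ K → ring (p ^ den a) (numRes a K))
    where
    ring : ∀ x u → x * (1 * u) ≡ x * u
    ring = solve-∀

  natQ-suc : ∀ k → natQ p (suc k) ≈ addQ p (natQ p k) (oneQ p)
  natQ-suc k = ≈-by-numRes (natQ p (suc k)) (addQ p (natQ p k) (oneQ p)) (λ K → suc k) (λ K → 1 * k + 1 * 1)
    (numRes-natQ (suc k) 0)
    (λ K → trans (numRes-addQ (natQ p k) (oneQ p) K)
                 (≡[p^]-+ K (≡[p^]-*ˡ K 1 (numRes-natQ k 0 K)) (≡[p^]-*ˡ K 1 (numRes-natQ 1 0 K))))
    (λ K → ring k)
    where
    ring : ∀ k → 1 * suc k ≡ 1 * (1 * k + 1 * 1)
    ring = solve-∀

  powQ-inverseˡ : ∀ m → mulQ p (powQ p (ℤ.- + m)) (powQ p (+ m)) ≈ oneQ p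
  powQ-inverseˡ zero = ≈-by-numRes _ (oneQ p) (λ K → (1 * 1) * (1 * 1)) (λ K → 1)
    (λ K → trans (numRes-mulQ (powQ p (+ 0)) (powQ p (+ 0)) K) (≡[p^]-* K (numRes-powQ-+ 0 K) (numRes-powQ-+ 0 K)))
    (numRes-natQ 1 0)
    (λ K → refl)
  powQ-inverseˡ (suc m) = ≈-by-numRes _ (oneQ p) (λ K → 1 * (p ^ suc m * 1)) (λ K → 1)
    (λ K → trans (numRes-mulQ (powQ p -[1+ m ]) (powQ p (+ suc m)) K)
                 (≡[p^]-* K (numRes-natQ 1 (suc m) K) (numRes-powQ-+ (suc m) K)))
    (numRes-natQ 1 0)
    (λ K → trans (ring (p ^ suc m)) (cong (λ e → p ^ e * 1) (sym (+-identityʳ (suc m)))))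
    where
    ring : ∀ x → 1 * (1 * (x * 1)) ≡ x * 1
    ring = solve-∀

  addQ-congˡ : ∀ {a a'} b → a ≈ a' → addQ p a b ≈ addQ p a' b
  addQ-congˡ {a} {a'} b a≈a' = mk≈ λ K → begin
      (p ^ (d' + e) * numRes (addQ p a b) K) %p^ K
    ≡⟨ ≡[p^]-*ˡ K (p ^ (d' + e)) (numRes-addQ a b K) ⟩
      (p ^ (d' + e) * (p ^ e * numRes a K + p ^ d * numRes b K)) %p^ K
    ≡⟨ cong (_%p^ K) (expand d d' (numRes a K) (numRes b K)) ⟩
      ((p ^ e * p ^ e) * (p ^ d' * numRes a K) + (p ^ d * p ^ d' * p ^ e) * numRes b K) %p^ K
    ≡⟨ ≡[p^]-+ K {y = (p ^ d * p ^ d' * p ^ e) * numRes b K} (≡[p^]-*ˡ K (p ^ e * p ^ e) (cross a≈a' K)) refl ⟩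
      ((p ^ e * p ^ e) * (p ^ d * numRes a' K) + (p ^ d * p ^ d' * p ^ e) * numRes b K) %p^ K
    ≡⟨ cong (λ z → ((p ^ e * p ^ e) * (p ^ d * numRes a' K) + z * p ^ e * numRes b K) %p^ K) (*-comm (p ^ d) (p ^ d')) ⟩
      ((p ^ e * p ^ e) * (p ^ d * numRes a' K) + (p ^ d' * p ^ d * p ^ e) * numRes b K) %p^ K
    ≡⟨ cong (_%p^ K) (sym (expand d' d (numRes a' K) (numRes b K))) ⟩
      (p ^ (d + e) * (p ^ e * numRes a' K + p ^ d' * numRes b K)) %p^ K
    ≡⟨ sym (≡[p^]-*ˡ K (p ^ (d + e)) (numRes-addQ a' b K)) ⟩
      (p ^ (d + e) * numRes (addQ p a' b) K) %p^ K ∎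
    where
    open ≡-Reasoning
    d = den a
    d' = den a'
    e = den b
    expand : ∀ d d' u v → p ^ (d' + e) * (p ^ e * u + p ^ d * v) ≡ (p ^ e * p ^ e) * (p ^ d' * u) + (p ^ d * p ^ d' * p ^ e) * v
    expand d d' u v rewrite p^-+ d' e = ring (p ^ d) (p ^ d') (p ^ e) u v
      where
      ring : ∀ x y z u v → y * z * (z * u + x * v) ≡ (z * z) * (y * u) + (x * y * z) * v
      ring = solve-∀

  mulQ-congˡ : ∀ {a a'} b → a ≈ a' → mulQ p a b ≈ mulQ p a' b
  mulQ-congˡ {a} {a'} b a≈a' = mk≈ λ K → begin
      (p ^ (d' + e) * numRes (mulQ p a b) K) %p^ K
    ≡⟨ ≡[p^]-*ˡ K (p ^ (d' + e)) (numRes-mulQ a b K) ⟩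
      (p ^ (d' + e) * (numRes a K * numRes b K)) %p^ K
    ≡⟨ cong (_%p^ K) (regroup d' (numRes a K) (numRes b K)) ⟩
      ((p ^ d' * numRes a K) * (p ^ e * numRes b K)) %p^ K
    ≡⟨ ≡[p^]-* K {y = p ^ e * numRes b K} (cross a≈a' K) refl ⟩
      ((p ^ d * numRes a' K) * (p ^ e * numRes b K)) %p^ K
    ≡⟨ cong (_%p^ K) (sym (regroup d (numRes a' K) (numRes b K))) ⟩
      (p ^ (d + e) * (numRes a' K * numRes b K)) %p^ K
    ≡⟨ sym (≡[p^]-*ˡ K (p ^ (d + e)) (numRes-mulQ a' b K)) ⟩
      (p ^ (d + e) * numRes (mulQ p a' b) K) %p^ K ∎
    where
    open ≡-Reasoning
    d = den a
    d' = den a'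
    e = den b
    regroup : ∀ d u v → p ^ (d + e) * (u * v) ≡ (p ^ d * u) * (p ^ e * v)
    regroup d u v rewrite p^-+ d e = ring (p ^ d) (p ^ e) u v
      where
      ring : ∀ x z u v → x * z * (u * v) ≡ (x * u) * (z * v)
      ring = solve-∀

  addQ-congʳ : ∀ a {b b'} → b ≈ b' → addQ p a b ≈ addQ p a b'
  addQ-congʳ a {b} {b'} b≈b' = ≈-trans (addQ-comm a b) (≈-trans (addQ-congˡ a b≈b') (addQ-comm b' a))

  mulQ-congʳ : ∀ a {b b'} → b ≈ b' → mulQ p a b ≈ mulQ p a b'
  mulQ-congʳ a {b} {b'} b≈b' = ≈-trans (mulQ-comm a b) (≈-trans (mulQ-congˡ a b≈b') (mulQ-comm b' a))

  addQ-cong : ∀ {a a' b b'} → a ≈ a' → b ≈ b' → addQ p a b ≈ addQ p a' b'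
  addQ-cong {a' = a'} {b = b} a≈a' b≈b' = ≈-trans (addQ-congˡ b a≈a') (addQ-congʳ a' b≈b')

  addQ-identityʳ : ∀ a → addQ p a (zeroQ p) ≈ a
  addQ-identityʳ a = ≈-trans (addQ-comm a (zeroQ p)) (addQ-identityˡ a)

  mulQ-distribʳ-addQ : ∀ a b c → mulQ p (addQ p a b) c ≈ addQ p (mulQ p a c) (mulQ p b c)
  mulQ-distribʳ-addQ a b c = begin
      mulQ p (addQ p a b) c            ≈⟨ mulQ-comm (addQ p a b) c ⟩
      mulQ p c (addQ p a b)            ≈⟨ mulQ-distribˡ-addQ c a b ⟩
      addQ p (mulQ p c a) (mulQ p c b) ≈⟨ addQ-cong (mulQ-comm c a) (mulQ-comm c b) ⟩
      addQ p (mulQ p a c) (mulQ p b c) ∎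
    where open SetoidReasoning Qp-setoid

  addQ-interchange : ∀ a b c d → addQ p (addQ p a b) (addQ p c d) ≈ addQ p (addQ p a c) (addQ p b d)
  addQ-interchange a b c d = begin
      addQ p (addQ p a b) (addQ p c d) ≈⟨ addQ-assoc a b (addQ p c d) ⟩
      addQ p a (addQ p b (addQ p c d)) ≈⟨ addQ-congʳ a (≈-sym (addQ-assoc b c d)) ⟩
      addQ p a (addQ p (addQ p b c) d) ≈⟨ addQ-congʳ a (addQ-congˡ d (addQ-comm b c)) ⟩
      addQ p a (addQ p (addQ p c b) d) ≈⟨ addQ-congʳ a (addQ-assoc c b d) ⟩
      addQ p a (addQ p c (addQ p b d)) ≈⟨ ≈-sym (addQ-assoc a c (addQ p b d)) ⟩
      addQ p (addQ p a c) (addQ p b d) ∎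
    where open SetoidReasoning Qp-setoid

  -- Valuation bounds

  DivPow : Zp p → ℕ → Set
  DivPow u L = res p u L ≡ 0

  DivPow-mono : ∀ u {L' L} → L' ≤ L → DivPow u L → DivPow u L'
  DivPow-mono u {L'} {L} L'≤L p^L∣u = m+n≡0⇒m≡0 (res p u L')
    (trans (sym (res-+ u L' (L ∸ L'))) (trans (cong (res p u) (m+[n∸m]≡n L'≤L)) p^L∣u))

  DivPow⇒res≡p^* : ∀ u L → DivPow u L → ∀ j → Σ ℕ λ X → res p u (L + j) ≡ p ^ L * X
  DivPow⇒res≡p^* u L p^L∣u j =
    res p (λ i → u (L + i)) j , trans (res-+ u L j) (cong (_+ p ^ L * res p (λ i → u (L + i)) j) p^L∣u)

  DivPow-addZ : ∀ u v L → DivPow u L → DivPow v L → DivPow (addZ p u v) L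
  DivPow-addZ u v L p^L∣u p^L∣v =
    trans (res-addZ u v L) (trans (cong₂ (λ a b → (a + b) %p^ L) p^L∣u p^L∣v) (m*n%n≡0 0 (p ^ L) {{p^≢0 L}}))

  DivPow-mulZ : ∀ u v L₁ L₂ → DivPow u L₁ → DivPow v L₂ → DivPow (mulZ p u v) (L₁ + L₂)
  DivPow-mulZ u v L₁ L₂ p^L₁∣u p^L₂∣v with DivPow⇒res≡p^* u L₁ p^L₁∣u L₂ | DivPow⇒res≡p^* v L₂ p^L₂∣v L₁
  ... | X , u≡ | Y , v≡ = begin
      res p (mulZ p u v) (L₁ + L₂)                          ≡⟨ res-mulZ u v (L₁ + L₂) ⟩
      (res p u (L₁ + L₂) * res p v (L₁ + L₂)) %p^ (L₁ + L₂) ≡⟨ cong₂ (λ a b → (a * b) %p^ (L₁ + L₂)) u≡ (trans (cong (res p v) (+-comm L₁ L₂)) v≡) ⟩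
      (p ^ L₁ * X * (p ^ L₂ * Y)) %p^ (L₁ + L₂)              ≡⟨ cong (_%p^ (L₁ + L₂)) (regroup (p ^ L₁) (p ^ L₂) X Y) ⟩
      (p ^ L₁ * p ^ L₂ * (X * Y)) %p^ (L₁ + L₂)              ≡⟨ cong (λ z → (z * (X * Y)) %p^ (L₁ + L₂)) (sym (p^-+ L₁ L₂)) ⟩
      (p ^ (L₁ + L₂) * (X * Y)) %p^ (L₁ + L₂)                ≡⟨ p^*-%p^≡0 (L₁ + L₂) (L₁ + L₂) (X * Y) ≤-refl ⟩
      0                                                     ∎
    where
    open ≡-Reasoning
    regroup : ∀ a b X Y → a * X * (b * Y) ≡ a * b * (X * Y)
    regroup = solve-∀

  DivPow-shiftZ : ∀ k u L → DivPow u L → DivPow (shiftZ p k u) (k + L)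
  DivPow-shiftZ k u L p^L∣u with DivPow⇒res≡p^* u L p^L∣u k
  ... | X , u≡ = begin
      res p (shiftZ p k u) (k + L)              ≡⟨ res-shiftZ k u (k + L) ⟩
      (p ^ k * res p u (k + L)) %p^ (k + L)     ≡⟨ cong (λ z → (p ^ k * z) %p^ (k + L)) (trans (cong (res p u) (+-comm k L)) u≡) ⟩
      (p ^ k * (p ^ L * X)) %p^ (k + L)         ≡⟨ cong (_%p^ (k + L)) (trans (sym (*-assoc (p ^ k) (p ^ L) X)) (cong (_* X) (sym (p^-+ k L)))) ⟩
      (p ^ (k + L) * X) %p^ (k + L)             ≡⟨ p^*-%p^≡0 (k + L) (k + L) X ≤-refl ⟩
      0                                         ∎
    where open ≡-Reasoning

  p^*res-%p^≡0 : ∀ u M → DivPow u M → ∀ K d → K ≤ d + M → (p ^ d * res p u K) %p^ K ≡ 0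
  p^*res-%p^≡0 u M p^M∣u K d K≤d+M with ≤-total M K
  ... | inj₁ M≤K with DivPow⇒res≡p^* u M p^M∣u (K ∸ M)
  ...   | X , u≡ = trans (cong (λ z → (p ^ d * z) %p^ K) (trans (cong (res p u) (sym (m+[n∸m]≡n M≤K))) u≡))
                     (trans (cong (_%p^ K) (trans (sym (*-assoc (p ^ d) (p ^ M) X)) (cong (_* X) (sym (p^-+ d M)))))
                            (p^*-%p^≡0 K (d + M) X K≤d+M))
  p^*res-%p^≡0 u M p^M∣u K d K≤d+M | inj₂ K≤M =
    trans (cong (λ z → (p ^ d * z) %p^ K) (DivPow-mono u K≤M p^M∣u))
          (trans (cong (_%p^ K) (*-zeroʳ (p ^ d))) (m*n%n≡0 0 (p ^ K) {{p^≢0 K}}))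

  VGe⇒DivPow : ∀ a n → VGe p a n → DivPow (num a) (max0 (n ℤ.+ + den a))
  VGe⇒DivPow a n a≥n with n ℤ.+ + den a | a≥n
  ... | + k      | a≥n' = a≥n' k ℤP.≤-refl
  ... | -[1+ k ] | _    = refl

  DivPow⇒VGe : ∀ a n → DivPow (num a) (max0 (n ℤ.+ + den a)) → VGe p a n
  DivPow⇒VGe a n p^∣a m m≤ = DivPow-mono (num a) (≤-max0 m _ m≤) p^∣a

  VGe-mono : ∀ a {n' n} → n' ℤ.≤ n → VGe p a n → VGe p a n'
  VGe-mono a n'≤n a≥n m m≤ = a≥n m (ℤP.≤-trans m≤ (ℤP.+-monoˡ-≤ (+ den a) n'≤n))

  VGe-vacuous : ∀ a n → n ℤ.+ + den a ℤ.≤ + 0 → VGe p a n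
  VGe-vacuous a n _   zero    _  = refl
  VGe-vacuous a n n≤ (suc m) m≤ with ℤP.≤-trans m≤ n≤
  ... | ℤ.+≤+ ()

  VGe-below-den : ∀ a d → den a ≤ d → VGe p a (ℤ.- + d)
  VGe-below-den a d den≤d = VGe-vacuous a (ℤ.- + d)
    (ℤP.≤-trans (ℤP.≤-reflexive (ℤP.+-comm (ℤ.- + d) (+ den a))) (ℤP.i≤j⇒i-j≤0 (ℤ.+≤+ den≤d)))

  VGe-zeroQ : ∀ n → VGe p (zeroQ p) n
  VGe-zeroQ n = DivPow⇒VGe (zeroQ p) n (numRes-zeroQ (max0 (n ℤ.+ + 0)))

  VGe-integral : ∀ u → VGe p (u /p^ 0) (+ 0)
  VGe-integral u = VGe-vacuous (u /p^ 0) (+ 0) ℤP.≤-refl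

  VGe-powQ : ∀ s → VGe p (powQ p s) s
  VGe-powQ (+ k)    = DivPow⇒VGe (powQ p (+ k)) (+ k) (DivPow-shiftZ k (natZ p 1) 0 refl)
  VGe-powQ -[1+ k ] = VGe-vacuous (powQ p -[1+ k ]) -[1+ k ] (ℤP.≤-reflexive (ℤP.+-inverseˡ (+ suc k)))

  max0-+den : ∀ n d e → max0 (n ℤ.+ + (d + e)) ≤ e + max0 (n ℤ.+ + d)
  max0-+den n d e = max0-≤ _ _ (begin
      n ℤ.+ + (d + e)              ≡⟨ cong (λ z → n ℤ.+ z) (ℤP.pos-+ d e) ⟩
      n ℤ.+ (+ d ℤ.+ + e)          ≡⟨ sym (ℤP.+-assoc n (+ d) (+ e)) ⟩
      n ℤ.+ + d ℤ.+ + e            ≤⟨ ℤP.+-monoˡ-≤ (+ e) (≤max0 (n ℤ.+ + d)) ⟩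
      + max0 (n ℤ.+ + d) ℤ.+ + e   ≡⟨ sym (ℤP.pos-+ (max0 (n ℤ.+ + d)) e) ⟩
      + (max0 (n ℤ.+ + d) + e)     ≡⟨ cong +_ (+-comm _ e) ⟩
      + (e + max0 (n ℤ.+ + d))     ∎)
    where open ℤP.≤-Reasoning

  VGe-addQ : ∀ a b n → VGe p a n → VGe p b n → VGe p (addQ p a b) n
  VGe-addQ a b n a≥n b≥n = DivPow⇒VGe (addQ p a b) n (DivPow-addZ a' b' (max0 (n ℤ.+ + (den a + den b)))
    (DivPow-mono a' (max0-+den n (den a) (den b)) (DivPow-shiftZ (den b) (num a) _ (VGe⇒DivPow a n a≥n)))
    (DivPow-mono b' b'-level (DivPow-shiftZ (den a) (num b) _ (VGe⇒DivPow b n b≥n))))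
    where
    a' = shiftZ p (den b) (num a)
    b' = shiftZ p (den a) (num b)
    b'-level : max0 (n ℤ.+ + (den a + den b)) ≤ den a + max0 (n ℤ.+ + den b)
    b'-level = subst (λ z → max0 (n ℤ.+ + z) ≤ den a + max0 (n ℤ.+ + den b)) (+-comm (den b) (den a)) (max0-+den n (den b) (den a))

  VGe-mulQ : ∀ a b n m → VGe p a n → VGe p b m → VGe p (mulQ p a b) (n ℤ.+ m)
  VGe-mulQ a b n m a≥n b≥m = DivPow⇒VGe (mulQ p a b) (n ℤ.+ m)
    (DivPow-mono (mulZ p (num a) (num b)) level≤
      (DivPow-mulZ (num a) (num b) (max0 (n ℤ.+ + den a)) (max0 (m ℤ.+ + den b)) (VGe⇒DivPow a n a≥n) (VGe⇒DivPow b m b≥m)))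
    where
    level≡ : (n ℤ.+ m) ℤ.+ + (den a + den b) ≡ (n ℤ.+ + den a) ℤ.+ (m ℤ.+ + den b)
    level≡ rewrite ℤP.pos-+ (den a) (den b) = ring n m (+ den a) (+ den b)
      where
      ring : ∀ n m x y → (n ℤ.+ m) ℤ.+ (x ℤ.+ y) ≡ (n ℤ.+ x) ℤ.+ (m ℤ.+ y)
      ring = ℤSolver.solve-∀
    level≤ : max0 ((n ℤ.+ m) ℤ.+ + (den a + den b)) ≤ max0 (n ℤ.+ + den a) + max0 (m ℤ.+ + den b)
    level≤ = subst (λ z → max0 z ≤ max0 (n ℤ.+ + den a) + max0 (m ℤ.+ + den b)) (sym level≡) (max0-+ (n ℤ.+ + den a) (m ℤ.+ + den b))

  VGe-resp-≈ : ∀ a b n → a ≈ b → VGe p b n → VGe p a n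
  VGe-resp-≈ a b n a≈b b≥n = DivPow⇒VGe a n (level (n ℤ.+ + den a) refl)
    where
    level : ∀ z → z ≡ n ℤ.+ + den a → DivPow (num a) (max0 z)
    level -[1+ k ] _  = refl
    level (+ L)    L≡ = trans (sym (res-%p^ (num a) (m≤n+m L (den b)))) (trans cancelled (m*n%n≡0 0 (p ^ L) {{p^≢0 L}}))
      where
      K = den b + L
      K≡ : + K ≡ (n ℤ.+ + den b) ℤ.+ + den a
      K≡ = trans (ℤP.pos-+ (den b) L) (trans (cong (λ z → + den b ℤ.+ z) L≡) (ring (+ den b) n (+ den a)))
        where
        ring : ∀ x n y → x ℤ.+ (n ℤ.+ y) ≡ (n ℤ.+ x) ℤ.+ y
        ring = ℤSolver.solve-∀
      K≤ : K ≤ den a + max0 (n ℤ.+ + den b)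
      K≤ = ℤP.drop‿+≤+ (ℤP.≤-trans (ℤP.≤-reflexive K≡)
             (ℤP.≤-trans (ℤP.+-monoˡ-≤ (+ den a) (≤max0 (n ℤ.+ + den b)))
               (ℤP.≤-reflexive (trans (sym (ℤP.pos-+ _ (den a))) (cong +_ (+-comm _ (den a)))))))
      rhs≡0 : (p ^ den a * numRes b K) %p^ K ≡ 0
      rhs≡0 = p^*res-%p^≡0 (num b) _ (VGe⇒DivPow b n b≥n) K (den a) K≤
      cancelled : numRes a K ≡ 0 [p^ L ]
      cancelled = ≡[p^]-cancel (den b) L (numRes a K) 0
        (trans (cross a≈b K) (trans rhs≡0 (sym (trans (cong (_%p^ K) (*-zeroʳ (p ^ den b))) (m*n%n≡0 0 (p ^ K) {{p^≢0 K}})))))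

  VGe-mulQ-≤ : ∀ a b n m k → VGe p a n → VGe p b m → k ℤ.≤ n ℤ.+ m → VGe p (mulQ p a b) k
  VGe-mulQ-≤ a b n m k a≥n b≥m k≤ = VGe-mono (mulQ p a b) k≤ (VGe-mulQ a b n m a≥n b≥m)

  VGe-mulQ-integral : ∀ x a n → VGe p x (+ 0) → VGe p a n → VGe p (mulQ p x a) n
  VGe-mulQ-integral x a n x≥0 a≥n = VGe-mulQ-≤ x a (+ 0) n n x≥0 a≥n (ℤP.≤-reflexive (sym (ℤP.+-identityˡ n)))

  -- Coefficients of f(x + cT)

  coeff-addP : ∀ f g k → coeff p (addP p f g) k ≈ addQ p (coeff p f k) (coeff p g k)
  coeff-addP []      g       k       = ≈-sym (addQ-identityˡ (coeff p g k))
  coeff-addP (a ∷ f) []      k       = ≈-sym (addQ-identityʳ (coeff p (a ∷ f) k))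
  coeff-addP (a ∷ f) (b ∷ g) zero    = ≈-refl
  coeff-addP (a ∷ f) (b ∷ g) (suc k) = coeff-addP f g k

  coeff-map-mulQ : ∀ c g k → coeff p (map (mulQ p c) g) k ≈ mulQ p c (coeff p g k)
  coeff-map-mulQ c []      k       = ≈-sym (mulQ-zeroʳ c)
  coeff-map-mulQ c (b ∷ g) zero    = ≈-refl
  coeff-map-mulQ c (b ∷ g) (suc k) = coeff-map-mulQ c g k

  coeff-mulP-const : ∀ c g k → coeff p (mulP p (c ∷ []) g) k ≈ mulQ p c (coeff p g k)
  coeff-mulP-const c g k = begin
      coeff p (mulP p (c ∷ []) g) k                                       ≈⟨ coeff-addP (map (mulQ p c) g) (zeroQ p ∷ []) k ⟩
      addQ p (coeff p (map (mulQ p c) g) k) (coeff p (zeroQ p ∷ []) k)    ≈⟨ addQ-cong (coeff-map-mulQ c g k) (coeff-zeroQ∷[] k) ⟩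
      addQ p (mulQ p c (coeff p g k)) (zeroQ p)                           ≈⟨ addQ-identityʳ (mulQ p c (coeff p g k)) ⟩
      mulQ p c (coeff p g k)                                              ∎
    where
    open SetoidReasoning Qp-setoid
    coeff-zeroQ∷[] : ∀ k → coeff p (zeroQ p ∷ []) k ≈ zeroQ p
    coeff-zeroQ∷[] zero    = ≈-refl
    coeff-zeroQ∷[] (suc k) = ≈-refl

  coeff-mulP-linear-zero : ∀ x c g → coeff p (mulP p (x ∷ c ∷ []) g) 0 ≈ mulQ p x (coeff p g 0)
  coeff-mulP-linear-zero x c g = begin
      coeff p (mulP p (x ∷ c ∷ []) g) 0               ≈⟨ coeff-addP (map (mulQ p x) g) (zeroQ p ∷ mulP p (c ∷ []) g) 0 ⟩
      addQ p (coeff p (map (mulQ p x) g) 0) (zeroQ p) ≈⟨ addQ-identityʳ (coeff p (map (mulQ p x) g) 0) ⟩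
      coeff p (map (mulQ p x) g) 0                    ≈⟨ coeff-map-mulQ x g 0 ⟩
      mulQ p x (coeff p g 0)                          ∎
    where open SetoidReasoning Qp-setoid

  coeff-mulP-linear-suc : ∀ x c g k → coeff p (mulP p (x ∷ c ∷ []) g) (suc k)
                                      ≈ addQ p (mulQ p x (coeff p g (suc k))) (mulQ p c (coeff p g k))
  coeff-mulP-linear-suc x c g k = ≈-trans (coeff-addP (map (mulQ p x) g) (zeroQ p ∷ mulP p (c ∷ []) g) (suc k))
                                          (addQ-cong (coeff-map-mulQ x g (suc k)) (coeff-mulP-const c g k))

  coeff-compP-linear-zero : ∀ a f x c → coeff p (compP p (a ∷ f) (x ∷ c ∷ [])) 0
                                        ≈ addQ p a (mulQ p x (coeff p (compP p f (x ∷ c ∷ [])) 0))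
  coeff-compP-linear-zero a f x c = ≈-trans (coeff-addP (a ∷ []) (mulP p (x ∷ c ∷ []) (compP p f (x ∷ c ∷ []))) 0)
                                            (addQ-congʳ a (coeff-mulP-linear-zero x c (compP p f (x ∷ c ∷ []))))

  coeff-compP-linear-suc : ∀ a f x c k → coeff p (compP p (a ∷ f) (x ∷ c ∷ [])) (suc k)
                           ≈ addQ p (mulQ p x (coeff p (compP p f (x ∷ c ∷ [])) (suc k)))
                                    (mulQ p c (coeff p (compP p f (x ∷ c ∷ [])) k))
  coeff-compP-linear-suc a f x c k = ≈-trans (coeff-addP (a ∷ []) (mulP p (x ∷ c ∷ []) (compP p f (x ∷ c ∷ []))) (suc k))
                                             (≈-trans (addQ-identityˡ (coeff p (mulP p (x ∷ c ∷ []) (compP p f (x ∷ c ∷ []))) (suc k))) (coeff-mulP-linear-suc x c (compP p f (x ∷ c ∷ [])) k))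

  coeff₀-compP-linear : ∀ f x c → coeff p (compP p f (x ∷ c ∷ [])) 0 ≈ eval p f x
  coeff₀-compP-linear []      x c = ≈-refl
  coeff₀-compP-linear (a ∷ f) x c =
    ≈-trans (coeff-compP-linear-zero a f x c) (addQ-congʳ a (mulQ-congʳ x (coeff₀-compP-linear f x c)))

  eval-derivFrom-suc : ∀ k t y → eval p (derivFrom p (suc k) t) y ≈ addQ p (eval p (derivFrom p k t) y) (eval p t y)
  eval-derivFrom-suc k []      y = ≈-sym (addQ-identityˡ (zeroQ p))
  eval-derivFrom-suc k (b ∷ t) y = begin
      addQ p (mulQ p (natQ p (suc k)) b) (mulQ p y (eval p (derivFrom p (suc (suc k)) t) y))
    ≈⟨ addQ-cong (≈-trans (mulQ-congˡ b (natQ-suc k))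
                          (≈-trans (mulQ-distribʳ-addQ (natQ p k) (oneQ p) b) (addQ-congʳ (mulQ p (natQ p k) b) (mulQ-identityˡ b))))
                 (≈-trans (mulQ-congʳ y (eval-derivFrom-suc (suc k) t y)) (mulQ-distribˡ-addQ y (eval p (derivFrom p (suc k) t) y) (eval p t y))) ⟩
      addQ p (addQ p (mulQ p (natQ p k) b) b) (addQ p (mulQ p y (eval p (derivFrom p (suc k) t) y)) (mulQ p y (eval p t y)))
    ≈⟨ addQ-interchange (mulQ p (natQ p k) b) b (mulQ p y (eval p (derivFrom p (suc k) t) y)) (mulQ p y (eval p t y)) ⟩
      addQ p (addQ p (mulQ p (natQ p k) b) (mulQ p y (eval p (derivFrom p (suc k) t) y))) (addQ p b (mulQ p y (eval p t y))) ∎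
    where open SetoidReasoning Qp-setoid

  eval-derivFrom-one : ∀ t y → eval p (derivFrom p 1 t) y ≈ addQ p (eval p t y) (mulQ p y (eval p (deriv p t) y))
  eval-derivFrom-one []      y = ≈-sym (≈-trans (addQ-identityˡ (mulQ p y (zeroQ p))) (mulQ-zeroʳ y))
  eval-derivFrom-one (b ∷ t) y = begin
      addQ p (mulQ p (natQ p 1) b) (mulQ p y (eval p (derivFrom p 2 t) y))
    ≈⟨ addQ-cong (mulQ-identityˡ b) (≈-trans (mulQ-congʳ y (eval-derivFrom-suc 1 t y)) (mulQ-distribˡ-addQ y (eval p (derivFrom p 1 t) y) (eval p t y))) ⟩
      addQ p b (addQ p (mulQ p y (eval p (derivFrom p 1 t) y)) (mulQ p y (eval p t y)))
    ≈⟨ addQ-congʳ b (addQ-comm (mulQ p y (eval p (derivFrom p 1 t) y)) (mulQ p y (eval p t y))) ⟩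
      addQ p b (addQ p (mulQ p y (eval p t y)) (mulQ p y (eval p (derivFrom p 1 t) y)))
    ≈⟨ ≈-sym (addQ-assoc b (mulQ p y (eval p t y)) (mulQ p y (eval p (derivFrom p 1 t) y))) ⟩
      addQ p (addQ p b (mulQ p y (eval p t y))) (mulQ p y (eval p (derivFrom p 1 t) y)) ∎
    where open SetoidReasoning Qp-setoid

  coeff₁-compP-linear : ∀ f x c → coeff p (compP p f (x ∷ c ∷ [])) 1 ≈ mulQ p c (eval p (deriv p f) x)
  coeff₁-compP-linear []      x c = ≈-sym (mulQ-zeroʳ c)
  coeff₁-compP-linear (a ∷ t) x c = begin
      coeff p (compP p (a ∷ t) (x ∷ c ∷ [])) 1                ≈⟨ coeff-compP-linear-suc a t x c 0 ⟩
      addQ p (mulQ p x (coeff p g 1)) (mulQ p c (coeff p g 0)) ≈⟨ addQ-cong (mulQ-congʳ x (coeff₁-compP-linear t x c))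
                                                                            (mulQ-congʳ c (coeff₀-compP-linear t x c)) ⟩
      addQ p (mulQ p x (mulQ p c t'x)) (mulQ p c tx)           ≈⟨ addQ-comm (mulQ p x (mulQ p c t'x)) (mulQ p c tx) ⟩
      addQ p (mulQ p c tx) (mulQ p x (mulQ p c t'x))           ≈⟨ addQ-congʳ (mulQ p c tx) swap ⟩
      addQ p (mulQ p c tx) (mulQ p c (mulQ p x t'x))           ≈⟨ ≈-sym (mulQ-distribˡ-addQ c tx (mulQ p x t'x)) ⟩
      mulQ p c (addQ p tx (mulQ p x t'x))                      ≈⟨ mulQ-congʳ c (≈-sym (eval-derivFrom-one t x)) ⟩
      mulQ p c (eval p (derivFrom p 1 t) x)                    ∎
    where
    open SetoidReasoning Qp-setoid
    g = compP p t (x ∷ c ∷ [])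
    tx = eval p t x
    t'x = eval p (deriv p t) x
    swap : mulQ p x (mulQ p c t'x) ≈ mulQ p c (mulQ p x t'x)
    swap = ≈-trans (≈-sym (mulQ-assoc x c t'x)) (≈-trans (mulQ-congˡ t'x (mulQ-comm x c)) (mulQ-assoc c x t'x))

  shiftLevel : ℤ → ℤ → ℕ → ℤ
  shiftLevel n s zero          = n
  shiftLevel n s (suc zero)    = n ℤ.+ s
  shiftLevel n s (suc (suc _)) = n ℤ.+ (s ℤ.+ s)

  n+s≤shiftLevel : ∀ n m j → n ℤ.+ + m ℤ.≤ shiftLevel n (+ m) (suc j)
  n+s≤shiftLevel n m zero    = ℤP.≤-refl
  n+s≤shiftLevel n m (suc j) = ℤP.+-monoʳ-≤ n (ℤP.i≤i+j (+ m) (+ m))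

  VGe-coeff-compP-linear : ∀ f x c n m → (∀ j → VGe p (coeff p f j) n) → VGe p x (+ 0) → VGe p c (+ m) →
                           ∀ k → VGe p (coeff p (compP p f (x ∷ c ∷ [])) k) (shiftLevel n (+ m) k)
  VGe-coeff-compP-linear []      x c n m f≥n x≥0 c≥m k = VGe-zeroQ (shiftLevel n (+ m) k)
  VGe-coeff-compP-linear (a ∷ t) x c n m f≥n x≥0 c≥m k =
    VGe-resp-≈ (coeff p (compP p (a ∷ t) (x ∷ c ∷ [])) k) (horner k) (shiftLevel n s k) (unfold k) (bound k)
    where
    s = + m
    g = compP p t (x ∷ c ∷ [])
    IH = VGe-coeff-compP-linear t x c n m (λ j → f≥n (suc j)) x≥0 c≥m
    horner : ℕ → Qp p
    horner zero    = addQ p a (mulQ p x (coeff p g 0))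
    horner (suc k) = addQ p (mulQ p x (coeff p g (suc k))) (mulQ p c (coeff p g k))
    unfold : ∀ k → coeff p (compP p (a ∷ t) (x ∷ c ∷ [])) k ≈ horner k
    unfold zero    = coeff-compP-linear-zero a t x c
    unfold (suc k) = coeff-compP-linear-suc a t x c k
    regroup : ∀ n s → n ℤ.+ (s ℤ.+ s) ≡ s ℤ.+ (n ℤ.+ s)
    regroup = ℤSolver.solve-∀
    bound : ∀ k → VGe p (horner k) (shiftLevel n s k)
    bound zero          = VGe-addQ a (mulQ p x (coeff p g 0)) n (f≥n 0) (VGe-mulQ-integral x (coeff p g 0) n x≥0 (IH 0))
    bound (suc zero)    = VGe-addQ (mulQ p x (coeff p g 1)) (mulQ p c (coeff p g 0)) (n ℤ.+ s)
      (VGe-mulQ-integral x (coeff p g 1) (n ℤ.+ s) x≥0 (IH 1))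
      (VGe-mulQ-≤ c (coeff p g 0) s n (n ℤ.+ s) c≥m (IH 0) (ℤP.≤-reflexive (ℤP.+-comm n s)))
    bound (suc (suc j)) = VGe-addQ (mulQ p x (coeff p g (2 + j))) (mulQ p c (coeff p g (suc j))) (n ℤ.+ (s ℤ.+ s))
      (VGe-mulQ-integral x (coeff p g (2 + j)) (n ℤ.+ (s ℤ.+ s)) x≥0 (IH (2 + j)))
      (VGe-mulQ-≤ c (coeff p g (suc j)) s (shiftLevel n s (suc j)) (n ℤ.+ (s ℤ.+ s)) c≥m (IH (suc j))
        (ℤP.≤-trans (ℤP.≤-reflexive (regroup n s)) (ℤP.+-monoʳ-≤ s (n+s≤shiftLevel n m j))))

  VGe-eval : ∀ f y n → (∀ j → VGe p (coeff p f j) n) → VGe p y (+ 0) → VGe p (eval p f y) n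
  VGe-eval []      y n f≥n y≥0 = VGe-zeroQ n
  VGe-eval (a ∷ t) y n f≥n y≥0 = VGe-addQ a (mulQ p y (eval p t y)) n (f≥n 0)
    (VGe-mulQ-integral y (eval p t y) n y≥0 (VGe-eval t y n (λ j → f≥n (suc j)) y≥0))

  VGe-coeff-derivFrom : ∀ k t n → (∀ j → VGe p (coeff p t j) n) → ∀ j → VGe p (coeff p (derivFrom p k t) j) n
  VGe-coeff-derivFrom k []      n t≥n j       = VGe-zeroQ n
  VGe-coeff-derivFrom k (b ∷ t) n t≥n zero    = VGe-mulQ-integral (natQ p k) b n (VGe-integral (natZ p k)) (t≥n 0)
  VGe-coeff-derivFrom k (b ∷ t) n t≥n (suc j) = VGe-coeff-derivFrom (suc k) t n (λ j → t≥n (suc j)) j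

  VGe-coeff-deriv : ∀ f n → (∀ j → VGe p (coeff p f j) n) → ∀ j → VGe p (coeff p (deriv p f) j) n
  VGe-coeff-deriv []      n f≥n j = VGe-zeroQ n
  VGe-coeff-deriv (a ∷ t) n f≥n   = VGe-coeff-derivFrom 1 t n (λ j → f≥n (suc j))

  VGe-values-of-StCand : ∀ f x m i n → (∀ j → VGe p (coeff p f j) n) →
                         StCand p (shiftPoly p f (fromZp p x) (+ m)) (suc (suc i)) →
                         VGe p (eval p f (fromZp p x)) (n ℤ.+ (+ m ℤ.+ + m)) ×
                         VGe p (eval p (deriv p f) (fromZp p x)) (n ℤ.+ + m)
  VGe-values-of-StCand f x m i n f≥n stable =
      VGe-resp-≈ (eval p f x̂) (coeff p g 0) lv (≈-sym (coeff₀-compP-linear f x̂ c)) g₀≥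
    , VGe-mono f'x (ℤP.≤-reflexive n+s≡)
        (VGe-resp-≈ f'x (mulQ p (powQ p (ℤ.- s)) (coeff p g 1)) (ℤ.- s ℤ.+ lv) f'x≈
          (VGe-mulQ (powQ p (ℤ.- s)) (coeff p g 1) (ℤ.- s) lv (VGe-powQ (ℤ.- s)) g₁≥))
    where
    s = + m
    x̂ = fromZp p x
    c = powQ p s
    f'x = eval p (deriv p f) x̂
    g = compP p f (x̂ ∷ c ∷ [])
    lv = n ℤ.+ (s ℤ.+ s)
    gₖ≥ : VGe p (coeff p g (suc (suc i))) lv
    gₖ≥ = VGe-coeff-compP-linear f x̂ c n m f≥n (VGe-integral x) (VGe-powQ s) (suc (suc i))
    g₀≥ : VGe p (coeff p g 0) lv
    g₀≥ = stable 0 (s≤s z≤n) lv gₖ≥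
    g₁≥ : VGe p (coeff p g 1) lv
    g₁≥ = stable 1 (s≤s (s≤s z≤n)) lv gₖ≥
    f'x≈ : f'x ≈ mulQ p (powQ p (ℤ.- s)) (coeff p g 1)
    f'x≈ = ≈-sym (begin
        mulQ p (powQ p (ℤ.- s)) (coeff p g 1)   ≈⟨ mulQ-congʳ (powQ p (ℤ.- s)) (coeff₁-compP-linear f x̂ c) ⟩
        mulQ p (powQ p (ℤ.- s)) (mulQ p c f'x)  ≈⟨ ≈-sym (mulQ-assoc (powQ p (ℤ.- s)) c f'x) ⟩
        mulQ p (mulQ p (powQ p (ℤ.- s)) c) f'x  ≈⟨ mulQ-congˡ f'x (powQ-inverseˡ m) ⟩
        mulQ p (oneQ p) f'x                     ≈⟨ mulQ-identityˡ f'x ⟩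
        f'x                                     ∎)
      where open SetoidReasoning Qp-setoid
    n+s≡ : n ℤ.+ s ≡ ℤ.- s ℤ.+ (n ℤ.+ (s ℤ.+ s))
    n+s≡ = ring n s
      where
      ring : ∀ n s → n ℤ.+ s ≡ ℤ.- s ℤ.+ (n ℤ.+ (s ℤ.+ s))
      ring = ℤSolver.solve-∀

  -- The bootstrap

  scaledValue : Poly p → Zp p → ℤ → Qp p
  scaledValue f x s = mulQ p (powQ p (1ℤ ℤ.- s)) (eval p f (fromZp p x))

  ScaledValuesVGe : Poly p → Zp p → ℤ → ℤ → Set
  ScaledValuesVGe f x s n = VGe p (scaledValue f x s) n × VGe p (scaledValue (deriv p f) x s) n

  VGe-scaledValue : ∀ g x s n k → VGe p (eval p g (fromZp p x)) n → k ℤ.≤ (1ℤ ℤ.- s) ℤ.+ n →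
                    VGe p (scaledValue g x s) k
  VGe-scaledValue g x s n k g≥n k≤ =
    VGe-mulQ-≤ (powQ p (1ℤ ℤ.- s)) (eval p g (fromZp p x)) (1ℤ ℤ.- s) n k (VGe-powQ (1ℤ ℤ.- s)) g≥n k≤

  KappaBound⇒VGe-coeff : ∀ f x s → KappaBound p f x s → ∀ n → ScaledValuesVGe f x s n → ∀ j → VGe p (coeff p f j) n
  KappaBound⇒VGe-coeff f x s κ n (fx≥n , f'x≥n) j = κ j n fx≥n f'x≥n

  ScaledValuesVGe-step-neg : ∀ f x m → KappaBound p f x -[1+ m ] →
                             ∀ n → ScaledValuesVGe f x -[1+ m ] n → ScaledValuesVGe f x -[1+ m ] (n ℤ.+ 1ℤ)
  ScaledValuesVGe-step-neg f x m κ n scaled≥n =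
      VGe-scaledValue f x s n (n ℤ.+ 1ℤ) (VGe-eval f (fromZp p x) n f≥n (VGe-integral x)) n+1≤
    , VGe-scaledValue (deriv p f) x s n (n ℤ.+ 1ℤ) (VGe-eval (deriv p f) (fromZp p x) n (VGe-coeff-deriv f n f≥n) (VGe-integral x)) n+1≤
    where
    s = -[1+ m ]
    f≥n = KappaBound⇒VGe-coeff f x s κ n scaled≥n
    n+1≤ : n ℤ.+ 1ℤ ℤ.≤ (1ℤ ℤ.- s) ℤ.+ n
    n+1≤ = ℤP.≤-trans (ℤP.+-monoʳ-≤ n (ℤ.+≤+ (s≤s z≤n))) (ℤP.≤-reflexive (ℤP.+-comm n (1ℤ ℤ.- s)))

  ScaledValuesVGe-step-pos : ∀ f x m i → KappaBound p f x (+ m) →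
                             StCand p (shiftPoly p f (fromZp p x) (+ m)) (suc (suc i)) →
                             ∀ n → ScaledValuesVGe f x (+ m) n → ScaledValuesVGe f x (+ m) (n ℤ.+ 1ℤ)
  ScaledValuesVGe-step-pos f x m i κ stable n scaled≥n =
      VGe-scaledValue f x s (n ℤ.+ (s ℤ.+ s)) (n ℤ.+ 1ℤ) (proj₁ values) (ℤP.≤-trans (ℤP.i≤i+j (n ℤ.+ 1ℤ) s) (ℤP.≤-reflexive (ring₁ n s)))
    , VGe-scaledValue (deriv p f) x s (n ℤ.+ s) (n ℤ.+ 1ℤ) (proj₂ values) (ℤP.≤-reflexive (ring₂ n s))
    where
    s = + m
    values = VGe-values-of-StCand f x m i n (KappaBound⇒VGe-coeff f x s κ n scaled≥n) stable
    ring₁ : ∀ n s → n ℤ.+ 1ℤ ℤ.+ s ≡ (1ℤ ℤ.- s) ℤ.+ (n ℤ.+ (s ℤ.+ s))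
    ring₁ = ℤSolver.solve-∀
    ring₂ : ∀ n s → n ℤ.+ 1ℤ ≡ (1ℤ ℤ.- s) ℤ.+ (n ℤ.+ s)
    ring₂ = ℤSolver.solve-∀

  ScaledValuesVGe-base : ∀ f x s → ScaledValuesVGe f x s (ℤ.- + (den (scaledValue f x s) + den (scaledValue (deriv p f) x s)))
  ScaledValuesVGe-base f x s =
      VGe-below-den P (den P + den Q) (m≤m+n (den P) (den Q))
    , VGe-below-den Q (den P + den Q) (m≤n+m (den Q) (den P))
    where
    P = scaledValue f x s
    Q = scaledValue (deriv p f) x s

  KappaBound⇒coeff-zero : ∀ f x s → KappaBound p f x s →
                          (∀ n → ScaledValuesVGe f x s n → ScaledValuesVGe f x s (n ℤ.+ 1ℤ)) →
                          ∀ j → IsZeroQ p (coeff p f j)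
  KappaBound⇒coeff-zero f x s κ step j n =
    KappaBound⇒VGe-coeff f x s κ n
      (ℤ-upward-induction (ScaledValuesVGe f x s) antitone n₀ (ScaledValuesVGe-base f x s) step n) j
    where
    n₀ = ℤ.- + (den (scaledValue f x s) + den (scaledValue (deriv p f) x s))
    antitone : ∀ {m n} → m ℤ.≤ n → ScaledValuesVGe f x s n → ScaledValuesVGe f x s m
    antitone m≤n (fx≥n , f'x≥n) = VGe-mono (scaledValue f x s) m≤n fx≥n , VGe-mono (scaledValue (deriv p f) x s) m≤n f'x≥n

proposition3p5 : (p : ℕ) .{{_ : NonZero p}} → Prime p →
    (f : Poly p) → ¬ (∀ k → IsZeroQ p (coeff p f k)) →
    (x : Zp p) → (s : ℤ) → KappaBound p f x s →
    ∀ k → StCand p (shiftPoly p f (fromZp p x) s) k → k ≤ 1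
proposition3p5 p _ f f≢0 x s        κ zero          _      = z≤n
proposition3p5 p _ f f≢0 x s        κ (suc zero)    _      = s≤s z≤n
proposition3p5 p _ f f≢0 x -[1+ m ] κ (suc (suc i)) _      =
  ⊥-elim (f≢0 (KappaBound⇒coeff-zero p f x -[1+ m ] κ (ScaledValuesVGe-step-neg p f x m κ)))
proposition3p5 p _ f f≢0 x (+ m)    κ (suc (suc i)) stable =
  ⊥-elim (f≢0 (KappaBound⇒coeff-zero p f x (+ m) κ (ScaledValuesVGe-step-pos p f x m i κ stable)))
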